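{- Let $G=(A,B,E)$ be a bipartite graph and let $E_1,E_2$ be a partition of $E$. Let $E'_1\subseteq E_1$ be such that for every $A'\subseteq A(E_1)$: $$\operatorname{deg}_{\max}\mathrm{semi}(A',B,E'_1)\le c\,\operatorname{deg}_{\max}\mathrm{semi}(A',B,E_1).$$ Then $\operatorname{deg}_{\max}\mathrm{semi}(A,B,E'_1\cup E_2)\le(c+1)\operatorname{deg}_{\max}\mathrm{semi}(A,B,E)$.
   Context: $A(F)$ is the set of $A$-endpoints of edges of $F$. $\deg_F(v)$ is the number of edges of $F$ at $v$; $\operatorname{deg}_{\max}F=\max_v\deg_F(v)$. For $X\subseteq A$ and $F\subseteq E$, a semi-matching of $(X,B,F)$ is a set $T$ of edges of $F$ between $X$ and $B$ with $\deg_T(a)=1$ for all $a\in X$; a degree-minimizing path with respect to $T$ is a path $b_1,a_1,b_2,\dots,a_{k-1},b_k$ ($a_i\in X$) with $(a_i,b_i)\in T$, $(a_i,b_{i+1})\in F\setminus T$, $\deg_T(b_1)\ge\deg_T(b_k)+2$; $\mathrm{semi}(X,B,F)$ denotes an optimal semi-matching (none such path), all of which share the same, minimum possible, maximum degree. It is assumed $G$ has a semi-matching. -}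

module Defs where

open import Data.Nat using (ℕ; zero; suc; _+_; _≤_; _⊔_)
open import Data.Fin using (Fin; zero; suc; inject₁; fromℕ; _≟_)
open import Data.Bool using (Bool; true; false; _∧_; _∨_; if_then_else_)
open import Data.List using (List; map; foldr; allFin)
open import Data.Nat.ListAction using (sum)
open import Data.Product using (Σ; ∃; _×_; _,_)
open import Data.Integer using (+_)
open import Data.Rational using (ℚ; _/_)
open import Function.Definitions using (Injective)
open import Relation.Binary.PropositionalEquality using (_≡_; _≢_)
open import Relation.Nullary using (¬_)
open import Relation.Nullary.Decidable using (⌊_⌋)

-- A bipartite graph (A,B,E) with A = Fin m, B = Fin n.
-- Edge sets F ⊆ A × B are Boolean relations; subsets X ⊆ A are Boolean predicates.
EdgeSet : ℕ → ℕ → Set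
EdgeSet m n = Fin m → Fin n → Bool

VSet : ℕ → Set
VSet m = Fin m → Bool

_∪ₑ_ : ∀ {m n} → EdgeSet m n → EdgeSet m n → EdgeSet m n
(F ∪ₑ F') a b = F a b ∨ F' a b

_⊆ₑ_ : ∀ {m n} → EdgeSet m n → EdgeSet m n → Set
F ⊆ₑ F' = ∀ a b → F a b ≡ true → F' a b ≡ true

IsPartition : ∀ {m n} → EdgeSet m n → EdgeSet m n → EdgeSet m n → Set
IsPartition E E₁ E₂ =
  (∀ a b → E a b ≡ (E₁ a b ∨ E₂ a b)) × (∀ a b → ¬ (E₁ a b ≡ true × E₂ a b ≡ true))

Aends : ∀ {m n} → EdgeSet m n → Fin m → Set
Aends {n = n} F a = ∃ λ (b : Fin n) → F a b ≡ true

_⊆ᵥA_ : ∀ {m n} → VSet m → EdgeSet m n → Set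
X ⊆ᵥA F = ∀ a → X a ≡ true → Aends F a

-- A semi-matching T of (X,B,F) is encoded by the assignment t : A → B,
-- where T = {(a, t a) | a ∈ X}; values of t outside X are irrelevant.
IsSemiMatching : ∀ {m n} → VSet m → EdgeSet m n → (Fin m → Fin n) → Set
IsSemiMatching X F t = ∀ a → X a ≡ true → F a (t a) ≡ true

deg : ∀ {m n} → VSet m → (Fin m → Fin n) → Fin n → ℕ
deg {m} X t b = sum (map (λ a → if X a ∧ ⌊ t a ≟ b ⌋ then 1 else 0) (allFin m))

-- deg_max T = max_b deg_T(b)   (A-vertices have degree ≤ 1 ≤ this unless T = ∅)
degMax : ∀ {m n} → VSet m → (Fin m → Fin n) → ℕ
degMax {m} {n} X t =
  foldr _⊔_ (foldr _⊔_ 0 (map (λ a → if X a then 1 else 0) (allFin m)))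
        (map (deg X t) (allFin n))

record DegMinPath {m n} (X : VSet m) (F : EdgeSet m n) (t : Fin m → Fin n) : Set where
  field
    k       : ℕ
    as      : Fin k → Fin m
    bs      : Fin (suc k) → Fin n
    as-inj  : Injective _≡_ _≡_ as
    bs-inj  : Injective _≡_ _≡_ bs
    as-in-X : ∀ i → X (as i) ≡ true
    in-T    : ∀ i → t (as i) ≡ bs (inject₁ i)
    in-F    : ∀ i → F (as i) (bs (suc i)) ≡ true
    notin-T : ∀ i → t (as i) ≢ bs (suc i)
    degdrop : deg X t (bs (fromℕ k)) + 2 ≤ deg X t (bs zero)

IsOptimal : ∀ {m n} → VSet m → EdgeSet m n → (Fin m → Fin n) → Set
IsOptimal X F t = IsSemiMatching X F t × ¬ DegMinPath X F t

allA : ∀ {m} → VSet m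
allA _ = true

toℚ : ℕ → ℚ
toℚ d = + d / 1

-- Let s be an optimal semi-matching of G and A₁ the vertices
-- that s matches through E₁. Re-optimising s on (A₁, B, E₁) gives t₁ with
-- deg_max t₁ ≤ deg_max s, and the hypothesis gives an optimal t′ of (A₁, B, E′₁) with
-- deg_max t′ ≤ c · deg_max t₁. Using t′ on A₁ and s elsewhere is a semi-matching of
-- (A, B, E′₁ ∪ E₂) of maximum degree at most deg_max t′ + deg_max s ≤ (c + 1) deg_max s,
-- and an optimal semi-matching has the least maximum degree of all semi-matchings.
--
-- If no degree-minimizing path starts at b₀,
-- the set C of B-vertices reachable from b₀ by alternating paths is closed: every a with
-- t a ∈ C has all its F-neighbours in C, and every vertex of C has degree at least
-- deg b₀ − 1. Any other semi-matching u also sends these a into C, so the total load of C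
-- under u is at least that under t, which forces deg_max u ≥ deg b₀. Existence of optimal
-- semi-matchings follows because shifting along a degree-minimizing path lowers Σ_b deg(b)².
module Submission where

open import Defs

module SemiMatchingTheory where

  open import Data.Bool using (Bool; true; false; _∧_; _∨_; not; if_then_else_)
  import Data.Bool.Properties as Boolₚ
  open import Data.Fin using (Fin; zero; suc; inject₁; fromℕ; punchIn; _≟_)
  import Data.Fin.Properties as Finₚ
  open Finₚ using (any?)
  open import Data.Fin.Induction using (<-weakInduction)
  open import Data.List using (map; foldr; allFin; tabulate)
  open import Data.List.Properties using (foldr-preservesᵇ; foldr-preservesᵒ)
  import Data.List.Relation.Unary.All.Properties as All
  import Data.List.Relation.Unary.Any.Properties as Any
  open import Data.Nat using (ℕ; zero; suc; _+_; _*_; _≤_; _<_; _⊔_; z≤n; _≤?_)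
  import Data.Nat.ListAction as ListAction
  open import Data.Nat.Properties hiding (_≟_)
  open import Data.Nat.Induction using (<-wellFounded)
  open import Data.Nat.Solver using (module +-*-Solver)
  open import Data.Product using (Σ; ∃; _×_; _,_)
  open import Data.Sum using (_⊎_; inj₁; inj₂; [_,_]; [_,_]′; map₂)
  open import Data.Vec.Functional using (Vector; _∷_)
  open import Function using (_∘_)
  open import Function.Definitions using (Injective)
  open import Induction.WellFounded using (Acc; acc)
  open import Relation.Binary.PropositionalEquality
    using (_≡_; _≢_; refl; sym; trans; cong; cong₂; subst; subst₂; module ≡-Reasoning)
  open import Relation.Nullary using (¬_; Dec; yes; no; contradiction)
  open import Relation.Nullary.Decidable using (⌊_⌋; _×-dec_)

  open import Algebra.Properties.Semiring.Sum +-*-semiring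
    using (sum; sum-syntax; sum-cong-≗; sum-remove; sum-replicate-zero; ∑-distrib-+; ∑-comm; *-distribˡ-sum)
  open import Algebra.Properties.CommutativeSemigroup +-commutativeSemigroup using (xy∙z≈xz∙y; xy∙z≈zy∙x)
  open +-*-Solver using (solve; _:=_; _:+_; _:*_; con)
  open ≡-Reasoning

  χ : Bool → ℕ
  χ β = if β then 1 else 0

  δ : ∀ {n} → Fin n → Fin n → ℕ
  δ x y = χ ⌊ x ≟ y ⌋

  ⌊⌋-true : ∀ {P : Set} (P? : Dec P) → P → ⌊ P? ⌋ ≡ true
  ⌊⌋-true (yes _) _ = refl
  ⌊⌋-true (no ¬p) p = contradiction p ¬p

  ⌊⌋-false : ∀ {P : Set} (P? : Dec P) → ¬ P → ⌊ P? ⌋ ≡ false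
  ⌊⌋-false (yes p) ¬p = contradiction p ¬p
  ⌊⌋-false (no _)  _  = refl

  ⌊⌋-witness : ∀ {P : Set} (P? : Dec P) → ⌊ P? ⌋ ≡ true → P
  ⌊⌋-witness (yes p) _ = p

  ⌊≟⌋-refl : ∀ {n} (x : Fin n) → ⌊ x ≟ x ⌋ ≡ true
  ⌊≟⌋-refl x = ⌊⌋-true (x ≟ x) refl

  ⌊≟⌋-≢ : ∀ {n} {x y : Fin n} → x ≢ y → ⌊ x ≟ y ⌋ ≡ false
  ⌊≟⌋-≢ {x = x} {y} = ⌊⌋-false (x ≟ y)

  δ-refl : ∀ {n} (x : Fin n) → δ x x ≡ 1
  δ-refl x = cong χ (⌊≟⌋-refl x)

  δ-≢ : ∀ {n} {x y : Fin n} → x ≢ y → δ x y ≡ 0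
  δ-≢ x≢y = cong χ (⌊≟⌋-≢ x≢y)

  ∃⊎∀ : ∀ {k} {P Q : Fin k → Set} → (∀ i → P i ⊎ Q i) → ∃ P ⊎ (∀ i → Q i)
  ∃⊎∀ {zero}  _   = inj₂ λ ()
  ∃⊎∀ {suc k} p⊎q with p⊎q zero | ∃⊎∀ (p⊎q ∘ suc)
  ... | inj₁ p | _            = inj₁ (zero , p)
  ... | inj₂ _ | inj₁ (i , p) = inj₁ (suc i , p)
  ... | inj₂ q | inj₂ qs      = inj₂ λ { zero → q ; (suc i) → qs i }

  ∷-injective-fresh : ∀ {A : Set} {k} {x : A} {xs : Vector A k} →
    (∀ j → x ≢ xs j) → Injective _≡_ _≡_ xs → Injective _≡_ _≡_ (x ∷ xs)
  ∷-injective-fresh fresh inj {zero}  {zero}  _  = refl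
  ∷-injective-fresh fresh inj {zero}  {suc j} eq = contradiction eq (fresh j)
  ∷-injective-fresh fresh inj {suc i} {zero}  eq = contradiction (sym eq) (fresh i)
  ∷-injective-fresh fresh inj {suc i} {suc j} eq = cong suc (inj eq)

  ∑-agree-off : ∀ {n} (f g : Vector ℕ n) x → (∀ y → y ≢ x → f y ≡ g y) → sum f + g x ≡ sum g + f x
  ∑-agree-off {suc n} f g x agree = begin
    sum f + g x                          ≡⟨ cong (_+ g x) (sum-remove {i = x} f) ⟩
    f x + sum (f ∘ punchIn x) + g x      ≡⟨ cong (λ r → f x + r + g x) rest ⟩
    f x + sum (g ∘ punchIn x) + g x      ≡⟨ xy∙z≈zy∙x (f x) (sum (g ∘ punchIn x)) (g x) ⟩
    g x + sum (g ∘ punchIn x) + f x      ≡⟨ cong (_+ f x) (sum-remove {i = x} g) ⟨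
    sum g + f x                          ∎
    where
    rest : sum (f ∘ punchIn x) ≡ sum (g ∘ punchIn x)
    rest = sum-cong-≗ (λ i → agree (punchIn x i) (Finₚ.punchInᵢ≢i x i))

  ∑-δ : ∀ {n} (w : Vector ℕ n) x → ∑[ b < n ] (w b * δ x b) ≡ w x
  ∑-δ {n} w x = +-cancelʳ-≡ 0 (∑[ b < n ] (w b * δ x b)) (w x) (begin
    ∑[ b < n ] (w b * δ x b) + 0  ≡⟨ ∑-agree-off {n} (λ b → w b * δ x b) (λ _ → 0) x off-x ⟩
    ∑[ b < n ] 0 + w x * δ x x    ≡⟨ cong₂ _+_ (sum-replicate-zero n) (cong (w x *_) (δ-refl x)) ⟩
    0 + w x * 1                   ≡⟨ *-identityʳ (w x) ⟩
    w x                           ≡⟨ +-identityʳ (w x) ⟨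
    w x + 0                       ∎)
    where
    off-x : ∀ y → y ≢ x → w y * δ x y ≡ 0
    off-x y y≢x = trans (cong (w y *_) (δ-≢ (y≢x ∘ sym))) (*-zeroʳ (w y))

  ∑-mono-≤ : ∀ {n} {f g : Vector ℕ n} → (∀ i → f i ≤ g i) → sum f ≤ sum g
  ∑-mono-≤ {zero}  f≤g = z≤n
  ∑-mono-≤ {suc n} f≤g = +-mono-≤ (f≤g zero) (∑-mono-≤ (f≤g ∘ suc))

  ∑-mono-< : ∀ {n} {f g : Vector ℕ n} → (∀ i → f i ≤ g i) → ∀ x → f x < g x → sum f < sum g
  ∑-mono-< {suc n} f≤g zero    fx<gx = +-mono-<-≤ fx<gx (∑-mono-≤ (f≤g ∘ suc))
  ∑-mono-< {suc n} f≤g (suc x) fx<gx = +-mono-≤-< (f≤g zero) (∑-mono-< (f≤g ∘ suc) x fx<gx)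

  sum-map-tabulate : ∀ {A : Set} {k} (f : A → ℕ) (h : Fin k → A) →
    ListAction.sum (map f (tabulate h)) ≡ ∑[ i < k ] f (h i)
  sum-map-tabulate {k = zero}  f h = refl
  sum-map-tabulate {k = suc k} f h = cong (f (h zero) +_) (sum-map-tabulate f (h ∘ suc))

  module _ {k} (z : ℕ) (f : Fin k → ℕ) where

    foldr-⊔-lub : ∀ {M} → z ≤ M → (∀ i → f i ≤ M) → foldr _⊔_ z (map f (allFin k)) ≤ M
    foldr-⊔-lub {M} z≤M f≤M = foldr-preservesᵇ {P = _≤ M} ⊔-lub z≤M (All.map⁺ (All.tabulate⁺ f≤M))

    ≤-foldr-⊔ : ∀ {v} → v ≤ z ⊎ (∃ λ i → v ≤ f i) → v ≤ foldr _⊔_ z (map f (allFin k))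
    ≤-foldr-⊔ {v} below = foldr-preservesᵒ {P = v ≤_} (λ x y → [ m≤n⇒m≤n⊔o y , m≤n⇒m≤o⊔n x ]) z _
      (map₂ (λ (i , v≤fi) → Any.map⁺ (Any.tabulate⁺ i v≤fi)) below)

  -- Degrees and maximum degrees

  module _ {m n : ℕ} where

    _⊆ᵥ_ : VSet m → VSet m → Set
    X ⊆ᵥ Y = ∀ a → X a ≡ true → Y a ≡ true

    deg-∑ : ∀ (X : VSet m) (u : Fin m → Fin n) b → deg X u b ≡ ∑[ a < m ] χ (X a ∧ ⌊ u a ≟ b ⌋)
    deg-∑ X u b = sum-map-tabulate (λ a → χ (X a ∧ ⌊ u a ≟ b ⌋)) (λ a → a)

    deg-mono : ∀ {X Y : VSet m} → X ⊆ᵥ Y → ∀ (u : Fin m → Fin n) b → deg X u b ≤ deg Y u b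
    deg-mono {X} {Y} X⊆Y u b rewrite deg-∑ X u b | deg-∑ Y u b = ∑-mono-≤ pointwise
      where
      pointwise : ∀ a → χ (X a ∧ ⌊ u a ≟ b ⌋) ≤ χ (Y a ∧ ⌊ u a ≟ b ⌋)
      pointwise a with X a in Xa
      ... | false = z≤n
      ... | true rewrite X⊆Y a Xa = ≤-refl

    deg-handshake : ∀ (X : VSet m) (u : Fin m → Fin n) (w : Vector ℕ n) →
      ∑[ b < n ] (w b * deg X u b) ≡ ∑[ a < m ] (χ (X a) * w (u a))
    deg-handshake X u w = begin
      ∑[ b < n ] (w b * deg X u b)                          ≡⟨ sum-cong-≗ expand ⟩
      ∑[ b < n ] ∑[ a < m ] (w b * χ (X a ∧ ⌊ u a ≟ b ⌋))   ≡⟨ ∑-comm (λ a b → w b * χ (X a ∧ ⌊ u a ≟ b ⌋)) ⟨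
      ∑[ a < m ] ∑[ b < n ] (w b * χ (X a ∧ ⌊ u a ≟ b ⌋))   ≡⟨ sum-cong-≗ collapse ⟩
      ∑[ a < m ] (χ (X a) * w (u a))                        ∎
      where
      expand : ∀ b → w b * deg X u b ≡ ∑[ a < m ] (w b * χ (X a ∧ ⌊ u a ≟ b ⌋))
      expand b = trans (cong (w b *_) (deg-∑ X u b)) (*-distribˡ-sum (w b) (λ a → χ (X a ∧ ⌊ u a ≟ b ⌋)))
      collapse : ∀ a → ∑[ b < n ] (w b * χ (X a ∧ ⌊ u a ≟ b ⌋)) ≡ χ (X a) * w (u a)
      collapse a with X a
      ... | false = trans (sum-cong-≗ (*-zeroʳ ∘ w)) (sum-replicate-zero n)
      ... | true  = trans (∑-δ w (u a)) (sym (+-identityʳ (w (u a))))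

    nonEmpty : VSet m → ℕ
    nonEmpty X = foldr _⊔_ 0 (map (χ ∘ X) (allFin m))

    deg≤degMax : ∀ (X : VSet m) (u : Fin m → Fin n) b → deg X u b ≤ degMax X u
    deg≤degMax X u b = ≤-foldr-⊔ (nonEmpty X) (deg X u) (inj₂ (b , ≤-refl))

    nonEmpty≤degMax : ∀ (X : VSet m) (u : Fin m → Fin n) → nonEmpty X ≤ degMax X u
    nonEmpty≤degMax X u = ≤-foldr-⊔ (nonEmpty X) (deg X u) (inj₁ ≤-refl)

    degMax-lub : ∀ {X : VSet m} {u : Fin m → Fin n} {M} →
      nonEmpty X ≤ M → (∀ b → deg X u b ≤ M) → degMax X u ≤ M
    degMax-lub {X} {u} = foldr-⊔-lub (nonEmpty X) (deg X u)

    degMax-mono : ∀ {X Y : VSet m} → X ⊆ᵥ Y → ∀ (u : Fin m → Fin n) → degMax X u ≤ degMax Y u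
    degMax-mono {X} {Y} X⊆Y u = degMax-lub
      (≤-trans nonEmpty-mono (nonEmpty≤degMax Y u))
      (λ b → ≤-trans (deg-mono X⊆Y u b) (deg≤degMax Y u b))
      where
      χ-mono : ∀ a → χ (X a) ≤ χ (Y a)
      χ-mono a with X a in Xa
      ... | false = z≤n
      ... | true rewrite X⊆Y a Xa = ≤-refl
      nonEmpty-mono : nonEmpty X ≤ nonEmpty Y
      nonEmpty-mono = foldr-⊔-lub 0 (χ ∘ X) z≤n (λ a → ≤-foldr-⊔ 0 (χ ∘ Y) (inj₂ (a , χ-mono a)))

    _[_↦_] : (Fin m → Fin n) → Fin m → Fin n → Fin m → Fin n
    (u [ a ↦ v ]) x = if ⌊ x ≟ a ⌋ then v else u x

    [↦]-at : ∀ (u : Fin m → Fin n) a v → (u [ a ↦ v ]) a ≡ v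
    [↦]-at u a v rewrite ⌊≟⌋-refl a = refl

    [↦]-≢ : ∀ (u : Fin m → Fin n) {a x} v → x ≢ a → (u [ a ↦ v ]) x ≡ u x
    [↦]-≢ u v x≢a rewrite ⌊≟⌋-≢ x≢a = refl

    deg-[↦] : ∀ (X : VSet m) (u : Fin m → Fin n) a v → X a ≡ true →
      ∀ b → deg X (u [ a ↦ v ]) b + δ (u a) b ≡ deg X u b + δ v b
    deg-[↦] X u a v Xa b rewrite deg-∑ X (u [ a ↦ v ]) b | deg-∑ X u b = begin
      sum moved + δ (u a) b  ≡⟨ cong (sum moved +_) (sym (at-a u)) ⟩
      sum moved + kept a     ≡⟨ ∑-agree-off moved kept a agree ⟩
      sum kept + moved a     ≡⟨ cong (sum kept +_) (at-a (u [ a ↦ v ])) ⟩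
      sum kept + δ ((u [ a ↦ v ]) a) b  ≡⟨ cong (λ y → sum kept + δ y b) ([↦]-at u a v) ⟩
      sum kept + δ v b       ∎
      where
      moved kept : Vector ℕ m
      moved y = χ (X y ∧ ⌊ (u [ a ↦ v ]) y ≟ b ⌋)
      kept  y = χ (X y ∧ ⌊ u y ≟ b ⌋)
      at-a : ∀ (w : Fin m → Fin n) → χ (X a ∧ ⌊ w a ≟ b ⌋) ≡ δ (w a) b
      at-a w rewrite Xa = refl
      agree : ∀ y → y ≢ a → moved y ≡ kept y
      agree y y≢a rewrite [↦]-≢ u v y≢a = refl

    patch : VSet m → (Fin m → Fin n) → (Fin m → Fin n) → Fin m → Fin n
    patch X u v a = if X a then u a else v a

    patch-isSemiMatching : ∀ {X : VSet m} {F : EdgeSet m n} {u v} →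
      IsSemiMatching X F u → IsSemiMatching (not ∘ X) F v → IsSemiMatching allA F (patch X u v)
    patch-isSemiMatching {X} su sv a _ with X a in Xa
    ... | true  = su a Xa
    ... | false = sv a (cong not Xa)

    deg-patch : ∀ (X : VSet m) u v b → deg allA (patch X u v) b ≡ deg X u b + deg (not ∘ X) v b
    deg-patch X u v b rewrite deg-∑ allA (patch X u v) b | deg-∑ X u b | deg-∑ (not ∘ X) v b =
      trans (sum-cong-≗ split) (∑-distrib-+ (λ a → χ (X a ∧ ⌊ u a ≟ b ⌋)) (λ a → χ (not (X a) ∧ ⌊ v a ≟ b ⌋)))
      where
      split : ∀ a → χ ⌊ patch X u v a ≟ b ⌋ ≡ χ (X a ∧ ⌊ u a ≟ b ⌋) + χ (not (X a) ∧ ⌊ v a ≟ b ⌋)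
      split a with X a
      ... | true  = sym (+-identityʳ _)
      ... | false = refl

    degMax-patch : ∀ (X : VSet m) u v → degMax allA (patch X u v) ≤ degMax X u + degMax allA v
    degMax-patch X u v = degMax-lub (≤-trans (nonEmpty≤degMax allA v) (m≤n+m _ _)) λ b →
      subst (_≤ _) (sym (deg-patch X u v b))
        (+-mono-≤ (deg≤degMax X u b) (≤-trans (deg-mono (λ _ _ → refl) v b) (deg≤degMax allA v b)))

    isSemiMatching-mono : ∀ {X : VSet m} {F F′ : EdgeSet m n} {u} →
      F ⊆ₑ F′ → IsSemiMatching X F u → IsSemiMatching X F′ u
    isSemiMatching-mono F⊆F′ su a Xa = F⊆F′ a _ (su a Xa)

    ⊆ₑ-∪ₑˡ : ∀ (F F′ : EdgeSet m n) → F ⊆ₑ (F ∪ₑ F′)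
    ⊆ₑ-∪ₑˡ F F′ a b Fab = cong (_∨ _) Fab

    ⊆ₑ-∪ₑʳ : ∀ (F F′ : EdgeSet m n) → F′ ⊆ₑ (F ∪ₑ F′)
    ⊆ₑ-∪ₑʳ F F′ a b F′ab = trans (cong (_ ∨_) F′ab) (Boolₚ.∨-zeroʳ _)

    outside-E₁-isSemiMatching : ∀ {E E₁ E₂ : EdgeSet m n} → IsPartition E E₁ E₂ →
      ∀ {s} → IsSemiMatching allA E s →
      IsSemiMatching (λ a → not (E₁ a (s a))) E₂ s
    outside-E₁-isSemiMatching {E} {E₁} {E₂} (E≡E₁∨E₂ , _) {s} s-sm a ¬E₁ = begin
      E₂ a (s a)                ≡⟨ cong (_∨ E₂ a (s a)) (Boolₚ.not-injective ¬E₁) ⟨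
      E₁ a (s a) ∨ E₂ a (s a)   ≡⟨ E≡E₁∨E₂ a (s a) ⟨
      E a (s a)                 ≡⟨ s-sm a refl ⟩
      true                      ∎

  -- Shifting along a degree-minimizing path

  square-expand : ∀ p i → p * p + (2 * p + i) * i ≡ (p + i) * (p + i)
  square-expand = solve 2 (λ p i → p :* p :+ (con 2 :* p :+ i) :* i := (p :+ i) :* (p :+ i)) refl

  -- Squaring d′ + δ x = d + δ y and summing gives Σ d′² + (2 d′ x + 1) = Σ d² + (2 d y + 1).
  ∑-squares-< : ∀ {n} (d d′ : Vector ℕ n) x y → (∀ b → d′ b + δ x b ≡ d b + δ y b) → d y + 2 ≤ d x →
    ∑[ b < n ] (d′ b * d′ b) < ∑[ b < n ] (d b * d b)
  ∑-squares-< {n} d d′ x y moved dy+2≤dx =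
    +-cancelʳ-< (2 * d y + 1) Σd′² Σd² (subst (Σd′² + (2 * d y + 1) <_) balance (+-monoʳ-< Σd′² gap))
    where
    Σd′² Σd² : ℕ
    Σd′² = ∑[ b < n ] (d′ b * d′ b)
    Σd²  = ∑[ b < n ] (d b * d b)
    cross : ∀ (e : Vector ℕ n) z → ∑[ b < n ] ((2 * e b + δ z b) * δ z b) ≡ 2 * e z + 1
    cross e z = trans (∑-δ (λ b → 2 * e b + δ z b) z) (cong (2 * e z +_) (δ-refl z))
    balance : Σd′² + (2 * d′ x + 1) ≡ Σd² + (2 * d y + 1)
    balance = begin
      Σd′² + (2 * d′ x + 1)                                   ≡⟨ cong (Σd′² +_) (cross d′ x) ⟨
      Σd′² + ∑[ b < n ] ((2 * d′ b + δ x b) * δ x b)          ≡⟨ ∑-distrib-+ (λ b → d′ b * d′ b) _ ⟨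
      ∑[ b < n ] (d′ b * d′ b + (2 * d′ b + δ x b) * δ x b)   ≡⟨ sum-cong-≗ squared ⟩
      ∑[ b < n ] (d b * d b + (2 * d b + δ y b) * δ y b)      ≡⟨ ∑-distrib-+ (λ b → d b * d b) _ ⟩
      Σd² + ∑[ b < n ] ((2 * d b + δ y b) * δ y b)            ≡⟨ cong (Σd² +_) (cross d y) ⟩
      Σd² + (2 * d y + 1)                                     ∎
      where
      squared : ∀ b → d′ b * d′ b + (2 * d′ b + δ x b) * δ x b ≡ d b * d b + (2 * d b + δ y b) * δ y b
      squared b = begin
        d′ b * d′ b + (2 * d′ b + δ x b) * δ x b  ≡⟨ square-expand (d′ b) (δ x b) ⟩
        (d′ b + δ x b) * (d′ b + δ x b)          ≡⟨ cong (λ r → r * r) (moved b) ⟩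
        (d b + δ y b) * (d b + δ y b)            ≡⟨ square-expand (d b) (δ y b) ⟨
        d b * d b + (2 * d b + δ y b) * δ y b    ∎
    y≢x : y ≢ x
    y≢x refl = <⇒≱ (+-monoʳ-< (d y) (n<1+n 1)) (≤-trans dy+2≤dx (m≤m+n (d y) 1))
    dx≡1+d′x : d x ≡ suc (d′ x)
    dx≡1+d′x = begin
      d x               ≡⟨ +-identityʳ (d x) ⟨
      d x + 0           ≡⟨ cong (d x +_) (δ-≢ y≢x) ⟨
      d x + δ y x       ≡⟨ moved x ⟨
      d′ x + δ x x      ≡⟨ cong (d′ x +_) (δ-refl x) ⟩
      d′ x + 1          ≡⟨ +-comm (d′ x) 1 ⟩
      suc (d′ x)        ∎
    gap : 2 * d y + 1 < 2 * d′ x + 1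
    gap = +-monoˡ-< 1 (*-monoʳ-< 2 (≤-pred (subst₂ _≤_ (+-comm (d y) 2) dx≡1+d′x dy+2≤dx)))

  module _ {m n} (X : VSet m) (F : EdgeSet m n) where

    shift : ∀ k → (Fin k → Fin m) → (Fin (suc k) → Fin n) → (Fin m → Fin n) → Fin m → Fin n
    shift zero    as bs u = u
    shift (suc k) as bs u = shift k (as ∘ suc) (bs ∘ suc) (u [ as zero ↦ bs (suc zero) ])

    shift-isSemiMatching : ∀ k as bs {u} → (∀ i → F (as i) (bs (suc i)) ≡ true) →
      IsSemiMatching X F u → IsSemiMatching X F (shift k as bs u)
    shift-isSemiMatching zero    as bs in-F su = su
    shift-isSemiMatching (suc k) as bs {u} in-F su =
      shift-isSemiMatching k (as ∘ suc) (bs ∘ suc) (in-F ∘ suc) su′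
      where
      su′ : IsSemiMatching X F (u [ as zero ↦ bs (suc zero) ])
      su′ a Xa with a ≟ as zero
      ... | yes refl = in-F zero
      ... | no _     = su a Xa

    shift-deg : ∀ k (as : Fin k → Fin m) bs (u : Fin m → Fin n) → Injective _≡_ _≡_ as →
      (∀ i → X (as i) ≡ true) → (∀ i → u (as i) ≡ bs (inject₁ i)) →
      ∀ b → deg X (shift k as bs u) b + δ (bs zero) b ≡ deg X u b + δ (bs (fromℕ k)) b
    shift-deg zero    as bs u _ _ _ b = refl
    shift-deg (suc k) as bs u as-inj as-in-X in-T b = +-cancelʳ-≡ δ₁ _ _ (begin
      deg X w b + δ₀ + δ₁    ≡⟨ xy∙z≈xz∙y (deg X w b) δ₀ δ₁ ⟩
      deg X w b + δ₁ + δ₀    ≡⟨ cong (_+ δ₀) rest ⟩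
      deg X u′ b + δₑ + δ₀   ≡⟨ xy∙z≈xz∙y (deg X u′ b) δₑ δ₀ ⟩
      deg X u′ b + δ₀ + δₑ   ≡⟨ cong (_+ δₑ) first ⟩
      deg X u b + δ₁ + δₑ    ≡⟨ xy∙z≈xz∙y (deg X u b) δ₁ δₑ ⟩
      deg X u b + δₑ + δ₁    ∎)
      where
      u′ = u [ as zero ↦ bs (suc zero) ]
      w  = shift k (as ∘ suc) (bs ∘ suc) u′
      δ₀ = δ (bs zero) b
      δ₁ = δ (bs (suc zero)) b
      δₑ = δ (bs (fromℕ (suc k))) b
      first : deg X u′ b + δ₀ ≡ deg X u b + δ₁
      first = subst (λ b₀ → deg X u′ b + δ b₀ b ≡ deg X u b + δ₁) (in-T zero)
        (deg-[↦] X u (as zero) (bs (suc zero)) (as-in-X zero) b)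
      rest : deg X w b + δ₁ ≡ deg X u′ b + δₑ
      rest = shift-deg k (as ∘ suc) (bs ∘ suc) u′ (λ eq → Finₚ.suc-injective (as-inj eq)) (as-in-X ∘ suc)
        (λ i → trans ([↦]-≢ u (bs (suc zero)) (λ eq → contradiction (as-inj eq) λ ())) (in-T (suc i))) b

    potential : (Fin m → Fin n) → ℕ
    potential u = ∑[ b < n ] (deg X u b * deg X u b)

    module _ {t : Fin m → Fin n} (p : DegMinPath X F t) where
      open DegMinPath p

      shiftAlong : Fin m → Fin n
      shiftAlong = shift k as bs t

      shiftAlong-isSemiMatching : IsSemiMatching X F t → IsSemiMatching X F shiftAlong
      shiftAlong-isSemiMatching = shift-isSemiMatching k as bs in-F

      potential-shiftAlong : potential shiftAlong < potential t
      potential-shiftAlong = ∑-squares-< (deg X t) (deg X shiftAlong) (bs zero) (bs (fromℕ k))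
        (shift-deg k as bs t as-inj as-in-X in-T) degdrop

  -- Alternating-path search

  module Search {m n} (X : VSet m) (F : EdgeSet m n) (t : Fin m → Fin n) where

    IsClosed : (Fin n → Bool) → Set
    IsClosed C = ∀ a b′ → X a ≡ true → C (t a) ≡ true → F a b′ ≡ true → C b′ ≡ true

    record ClosedAbove (D : ℕ) (b₀ : Fin n) : Set where
      field
        C      : Fin n → Bool
        b₀∈C   : C b₀ ≡ true
        closed : IsClosed C
        heavy  : ∀ b → C b ≡ true → D ≤ deg X t b + 1

    record PathToLow (D : ℕ) (R : Fin n → Bool) (b : Fin n) : Set where
      field
        k       : ℕ
        as      : Fin k → Fin m
        bs      : Fin (suc k) → Fin n
        bs-inj  : Injective _≡_ _≡_ bs
        as-in-X : ∀ i → X (as i) ≡ true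
        in-T    : ∀ i → t (as i) ≡ bs (inject₁ i)
        in-F    : ∀ i → F (as i) (bs (suc i)) ≡ true
        start   : bs zero ≡ b
        low     : deg X t (bs (fromℕ k)) + 2 ≤ D
        inside  : ∀ i → R (bs i) ≡ true

    toDegMinPath : ∀ {R b} → PathToLow (deg X t b) R b → DegMinPath X F t
    toDegMinPath p = record
      { k = k ; as = as ; bs = bs ; bs-inj = bs-inj ; as-in-X = as-in-X ; in-T = in-T ; in-F = in-F
      ; as-inj  = λ eq → Finₚ.inject₁-injective (bs-inj (trans (sym (in-T _)) (trans (cong t eq) (in-T _))))
      ; notin-T = λ i eq → Finₚ.<⇒≢ (Finₚ.≤̄⇒inject₁< Finₚ.≤-refl) (bs-inj (trans (sym (in-T i)) eq))
      ; degdrop = subst (λ b → deg X t (bs (fromℕ k)) + 2 ≤ deg X t b) (sym start) low }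
      where open PathToLow p

    module _ (D : ℕ) where

      widen : ∀ {R R′ b} → (∀ x → R x ≡ true → R′ x ≡ true) → PathToLow D R b → PathToLow D R′ b
      widen R⊆R′ p = record
        { k = k ; as = as ; bs = bs ; bs-inj = bs-inj ; as-in-X = as-in-X ; in-T = in-T ; in-F = in-F
        ; start = start ; low = low ; inside = λ i → R⊆R′ _ (inside i) }
        where open PathToLow p

      extend : ∀ {R R′ b′} a → X a ≡ true → F a b′ ≡ true → R (t a) ≡ false → R′ (t a) ≡ true →
        (∀ x → R x ≡ true → R′ x ≡ true) → PathToLow D R b′ → PathToLow D R′ (t a)
      extend {R} a Xa Fab′ Rta R′ta R⊆R′ p = record
        { k = suc k ; as = a ∷ as ; bs = t a ∷ bs
        ; bs-inj  = ∷-injective-fresh fresh bs-inj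
        ; as-in-X = λ { zero → Xa ; (suc i) → as-in-X i }
        ; in-T    = λ { zero → refl ; (suc i) → in-T i }
        ; in-F    = λ { zero → subst (λ b → F a b ≡ true) (sym start) Fab′ ; (suc i) → in-F i }
        ; start   = refl
        ; low     = low
        ; inside  = λ { zero → R′ta ; (suc i) → R⊆R′ _ (inside i) } }
        where
        open PathToLow p
        fresh : ∀ j → t a ≢ bs j
        fresh j eq = contradiction (trans (sym Rta) (trans (cong R eq) (inside j))) λ ()

      -- R grows from the vertices of degree ≤ D − 2 by adding t a whenever a has an F-edge into R;
      -- each added vertex inherits a simple path to a low vertex from that edge.
      record SearchState : Set where
        field
          R       : Fin n → Bool
          path    : ∀ b → R b ≡ true → PathToLow D R b
          has-low : ∀ b → deg X t b + 2 ≤ D → R b ≡ true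

      Frontier : (Fin n → Bool) → Fin m → Fin n → Set
      Frontier R a b′ = X a ≡ true × F a b′ ≡ true × R b′ ≡ true × R (t a) ≡ false

      frontier? : ∀ R a b′ → Dec (Frontier R a b′)
      frontier? R a b′ =
        X a Boolₚ.≟ true ×-dec F a b′ Boolₚ.≟ true ×-dec R b′ Boolₚ.≟ true ×-dec R (t a) Boolₚ.≟ false

      outside : (Fin n → Bool) → ℕ
      outside R = ∑[ b < n ] χ (not (R b))

      grow : (st : SearchState) → ∀ a b′ → Frontier (SearchState.R st) a b′ →
        Σ SearchState λ st′ → outside (SearchState.R st′) < outside (SearchState.R st)
      grow st a b′ (Xa , Fab′ , Rb′ , Rta) = st′ , shrinks
        where
        open SearchState st
        R′ : Fin n → Bool
        R′ x = ⌊ x ≟ t a ⌋ ∨ R x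
        R⊆R′ : ∀ x → R x ≡ true → R′ x ≡ true
        R⊆R′ x Rx = trans (cong (⌊ x ≟ t a ⌋ ∨_) Rx) (Boolₚ.∨-zeroʳ _)
        R′ta : R′ (t a) ≡ true
        R′ta = cong (_∨ R (t a)) (⌊≟⌋-refl (t a))
        R′-≢ : ∀ {x} → x ≢ t a → R′ x ≡ R x
        R′-≢ x≢ta = cong (_∨ R _) (⌊≟⌋-≢ x≢ta)
        path′ : ∀ x → R′ x ≡ true → PathToLow D R′ x
        path′ x R′x with x ≟ t a
        ... | yes refl = extend a Xa Fab′ Rta R′ta R⊆R′ (path b′ Rb′)
        ... | no _     = widen R⊆R′ (path x R′x)
        st′ : SearchState
        st′ = record { R = R′ ; path = path′ ; has-low = λ b low → R⊆R′ b (has-low b low) }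
        shrinks : outside R′ < outside R
        shrinks = ≤-reflexive (begin
          suc (outside R′)              ≡⟨ +-comm 1 (outside R′) ⟩
          outside R′ + χ (not false)    ≡⟨ cong (λ β → outside R′ + χ (not β)) Rta ⟨
          outside R′ + χ (not (R (t a))) ≡⟨ ∑-agree-off (χ ∘ not ∘ R′) (χ ∘ not ∘ R) (t a) (λ _ → cong (χ ∘ not) ∘ R′-≢) ⟩
          outside R + χ (not (R′ (t a))) ≡⟨ cong (λ β → outside R + χ (not β)) R′ta ⟩
          outside R + 0                 ≡⟨ +-identityʳ (outside R) ⟩
          outside R                     ∎)

      saturate : (st : SearchState) → Acc _<_ (outside (SearchState.R st)) →
        Σ SearchState λ st′ → ∀ a b′ → ¬ Frontier (SearchState.R st′) a b′
      saturate st (acc smaller) with any? (λ a → any? (λ b′ → frontier? (SearchState.R st) a b′))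
      ... | no none = st , λ a b′ fr → none (a , b′ , fr)
      ... | yes (a , b′ , fr) with grow st a b′ fr
      ...   | st′ , shrinks = saturate st′ (smaller shrinks)

      initial : SearchState
      initial = record { R = low? ; path = trivial ; has-low = λ b → ⌊⌋-true (deg X t b + 2 ≤? D) }
        where
        low? : Fin n → Bool
        low? b = ⌊ deg X t b + 2 ≤? D ⌋
        trivial : ∀ b → low? b ≡ true → PathToLow D low? b
        trivial b low-b = record
          { k = 0 ; as = λ () ; bs = λ _ → b ; bs-inj = λ { {zero} {zero} _ → refl }
          ; as-in-X = λ () ; in-T = λ () ; in-F = λ ()
          ; start = refl ; low = ⌊⌋-witness (deg X t b + 2 ≤? D) low-b ; inside = λ _ → low-b }

    path-or-closed : ∀ b₀ → DegMinPath X F t ⊎ ClosedAbove (deg X t b₀) b₀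
    path-or-closed b₀ with saturate (deg X t b₀) (initial _) (<-wellFounded _)
    ... | st , saturated with SearchState.R st b₀ in Rb₀
    ... | true  = inj₁ (toDegMinPath (SearchState.path st b₀ Rb₀))
    ... | false = inj₂ (record { C = not ∘ R ; b₀∈C = cong not Rb₀ ; closed = closed ; heavy = heavy })
      where
      open SearchState st
      closed : IsClosed (not ∘ R)
      closed a b′ Xa Cta Fab′ with R b′ in Rb′
      ... | false = refl
      ... | true  = contradiction (Xa , Fab′ , Rb′ , Boolₚ.not-injective Cta) (saturated a b′)
      heavy : ∀ b → not (R b) ≡ true → deg X t b₀ ≤ deg X t b + 1
      heavy b Cb with deg X t b + 2 ≤? deg X t b₀
      ... | yes low = contradiction (trans (sym (cong not (has-low b low))) Cb) λ ()
      ... | no high = ≤-pred (subst (deg X t b₀ <_) (+-suc (deg X t b) 1) (≰⇒> high))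

    closed-blocks-path : (∀ b₀ → ClosedAbove (deg X t b₀) b₀) → ¬ DegMinPath X F t
    closed-blocks-path closedAt p =
      <⇒≱ (+-monoʳ-< (deg X t (bs (fromℕ k))) (n<1+n 1)) (≤-trans degdrop (heavy _ (bs∈C (fromℕ k))))
      where
      open DegMinPath p
      open ClosedAbove (closedAt (bs zero))
      bs∈C : ∀ i → C (bs i) ≡ true
      bs∈C = <-weakInduction (λ i → C (bs i) ≡ true) b₀∈C λ i C-bsi →
        closed (as i) (bs (suc i)) (as-in-X i) (subst (λ b → C b ≡ true) (sym (in-T i)) C-bsi) (in-F i)

    degMinPath? : Dec (DegMinPath X F t)
    degMinPath? with ∃⊎∀ path-or-closed
    ... | inj₁ (_ , p)  = yes p
    ... | inj₂ closedAt = no (closed-blocks-path closedAt)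

    -- Each a ∈ X with t a ∈ C has u a ∈ C too, since u a is an F-neighbour of a and C is closed.
    closed-load-≤ : ∀ {C} → IsClosed C → ∀ {u} → IsSemiMatching X F u →
      ∑[ b < n ] (χ (C b) * deg X t b) ≤ ∑[ b < n ] (χ (C b) * deg X u b)
    closed-load-≤ {C} closed {u} su =
      subst₂ _≤_ (sym (deg-handshake X t (χ ∘ C))) (sym (deg-handshake X u (χ ∘ C))) (∑-mono-≤ pointwise)
      where
      pointwise : ∀ a → χ (X a) * χ (C (t a)) ≤ χ (X a) * χ (C (u a))
      pointwise a with X a in Xa | C (t a) in Cta
      ... | false | _     = z≤n
      ... | true  | false = z≤n
      ... | true  | true  rewrite closed a (u a) Xa Cta (su a Xa) = ≤-refl

    closed⇒deg≤degMax : ∀ {b₀} → ClosedAbove (deg X t b₀) b₀ →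
      ∀ {u} → IsSemiMatching X F u → deg X t b₀ ≤ degMax X u
    closed⇒deg≤degMax {b₀} cl {u} su with deg X t b₀ ≤? degMax X u
    ... | yes D≤M = D≤M
    ... | no  D≰M = contradiction
      (<-≤-trans (∑-mono-< below b₀ strict) (≤-trans (closed-load-≤ closed su) (∑-mono-≤ above)))
      (<-irrefl refl)
      where
      open ClosedAbove cl
      M = degMax X u
      M<D : M < deg X t b₀
      M<D = ≰⇒> D≰M
      below : ∀ b → χ (C b) * M ≤ χ (C b) * deg X t b
      below b with C b in Cb
      ... | false = z≤n
      ... | true  = *-monoʳ-≤ 1 (m<1+n⇒m≤n (subst (M <_) (+-comm (deg X t b) 1) (<-≤-trans M<D (heavy b Cb))))
      strict : χ (C b₀) * M < χ (C b₀) * deg X t b₀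
      strict rewrite b₀∈C = *-monoʳ-< 1 M<D
      above : ∀ b → χ (C b) * deg X u b ≤ χ (C b) * M
      above b = *-monoʳ-≤ (χ (C b)) (deg≤degMax X u b)

    noDegMinPath⇒degMax-minimal : ¬ DegMinPath X F t → ∀ {u} → IsSemiMatching X F u → degMax X t ≤ degMax X u
    noDegMinPath⇒degMax-minimal ¬path {u} su = degMax-lub {X = X} {u = t} (nonEmpty≤degMax X u) λ b₀ →
      [ (λ path → contradiction path ¬path) , (λ cl → closed⇒deg≤degMax cl su) ]′ (path-or-closed b₀)

  open Search using (degMinPath?; noDegMinPath⇒degMax-minimal) public

  optimal-exists : ∀ {m n} (X : VSet m) (F : EdgeSet m n) {s} → IsSemiMatching X F s → ∃ λ t → IsOptimal X F t
  optimal-exists X F {s} ss = descend s ss (<-wellFounded (potential X F s))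
    where
    descend : ∀ u → IsSemiMatching X F u → Acc _<_ (potential X F u) → ∃ λ t → IsOptimal X F t
    descend u su (acc smaller) with degMinPath? X F u
    ... | no ¬path = u , su , ¬path
    ... | yes path = descend (shiftAlong X F path) (shiftAlong-isSemiMatching X F path su)
                       (smaller (potential-shiftAlong X F path))

open SemiMatchingTheory
open import Data.Fin using (Fin)
open import Data.Integer as ℤ using (+_)
import Data.Integer.Properties as ℤₚ
open import Data.Nat as ℕ using (ℕ)
import Data.Nat.Properties as ℕₚ
open import Data.Nat.Coprimality using (Coprime; 1-coprimeTo) renaming (sym to coprime-sym)
open import Data.Product using (∃; _×_; _,_; proj₁; proj₂)
open import Data.Rational using (ℚ; 0ℚ; 1ℚ; _+_; _*_; _≤_; mkℚ; *≤*; NonNegative; nonNegative)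
open import Data.Rational.Properties
  using ( normalize-coprime; toℚᵘ-injective; toℚᵘ-homo-+; +-monoˡ-≤; *-monoˡ-≤-nonNeg; *-distribʳ-+; *-identityˡ
        ; module ≤-Reasoning)
import Data.Rational.Unnormalised as ℚᵘ
import Data.Rational.Unnormalised.Properties as ℚᵘₚ
open import Relation.Binary.PropositionalEquality
  using (_≡_; refl; sym; cong; cong₂; subst₂; module ≡-Reasoning)

coprime-to-1 : ∀ d → Coprime d 1
coprime-to-1 d = coprime-sym (1-coprimeTo d)

toℚ≡mkℚ : ∀ d → toℚ d ≡ mkℚ (+ d) 0 (coprime-to-1 d)
toℚ≡mkℚ d = normalize-coprime (coprime-to-1 d)

toℚ-mono : ∀ {a b} → a ℕ.≤ b → toℚ a ≤ toℚ b
toℚ-mono {a} {b} a≤b rewrite toℚ≡mkℚ a | toℚ≡mkℚ b =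
  *≤* (subst₂ ℤ._≤_ (sym (ℤₚ.*-identityʳ (+ a))) (sym (ℤₚ.*-identityʳ (+ b))) (ℤ.+≤+ a≤b))

toℚ-+ : ∀ a b → toℚ (a ℕ.+ b) ≡ toℚ a + toℚ b
toℚ-+ a b rewrite toℚ≡mkℚ (a ℕ.+ b) | toℚ≡mkℚ a | toℚ≡mkℚ b =
  toℚᵘ-injective (ℚᵘₚ.≃-trans (ℚᵘ.*≡* cross)
    (ℚᵘₚ.≃-sym (toℚᵘ-homo-+ (mkℚ (+ a) 0 (coprime-to-1 a)) (mkℚ (+ b) 0 (coprime-to-1 b)))))
  where
  open ≡-Reasoning
  cross : + (a ℕ.+ b) ℤ.* + 1 ≡ (+ a ℤ.* + 1 ℤ.+ + b ℤ.* + 1) ℤ.* + 1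
  cross = begin
    + (a ℕ.+ b) ℤ.* + 1                  ≡⟨ ℤₚ.*-identityʳ _ ⟩
    + (a ℕ.+ b)                          ≡⟨ ℤₚ.pos-+ a b ⟩
    + a ℤ.+ + b                          ≡⟨ cong₂ ℤ._+_ (ℤₚ.*-identityʳ (+ a)) (ℤₚ.*-identityʳ (+ b)) ⟨
    + a ℤ.* + 1 ℤ.+ + b ℤ.* + 1          ≡⟨ ℤₚ.*-identityʳ _ ⟨
    (+ a ℤ.* + 1 ℤ.+ + b ℤ.* + 1) ℤ.* + 1 ∎

lemma9 : ∀ {m n} (E E₁ E₂ E₁' : EdgeSet m n) (c : ℚ) →
    0ℚ ≤ c →
    IsPartition E E₁ E₂ →
    (∃ λ (s : Fin m → Fin n) → IsSemiMatching allA E s) →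
    E₁' ⊆ₑ E₁ →
    (∀ (A' : VSet m) → A' ⊆ᵥA E₁ →
      ∃ λ (t' : Fin m → Fin n) → IsOptimal A' E₁' t' ×
        (∀ (t : Fin m → Fin n) → IsOptimal A' E₁ t →
          toℚ (degMax A' t') ≤ c * toℚ (degMax A' t))) →
    ∀ (t : Fin m → Fin n) → IsOptimal allA (E₁' ∪ₑ E₂) t →
    ∀ (s : Fin m → Fin n) → IsOptimal allA E s →
    toℚ (degMax allA t) ≤ (c + 1ℚ) * toℚ (degMax allA s)
lemma9 {m} E E₁ E₂ E₁' c 0≤c partition _ _ hyp t (_ , t-optimal) s (s-sm , _) = begin
  toℚ (degMax allA t)                    ≤⟨ toℚ-mono (ℕₚ.≤-trans t≤w (degMax-patch A₁ t′ s)) ⟩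
  toℚ (degMax A₁ t′ ℕ.+ Dₛ)              ≡⟨ toℚ-+ (degMax A₁ t′) Dₛ ⟩
  toℚ (degMax A₁ t′) + toℚ Dₛ            ≤⟨ +-monoˡ-≤ (toℚ Dₛ) t′-bound ⟩
  c * toℚ (degMax A₁ t₁) + toℚ Dₛ        ≤⟨ +-monoˡ-≤ (toℚ Dₛ) (*-monoˡ-≤-nonNeg c (toℚ-mono t₁≤s)) ⟩
  c * toℚ Dₛ + toℚ Dₛ                    ≡⟨ cong (λ q → c * toℚ Dₛ + q) (*-identityˡ (toℚ Dₛ)) ⟨
  c * toℚ Dₛ + 1ℚ * toℚ Dₛ               ≡⟨ *-distribʳ-+ (toℚ Dₛ) c 1ℚ ⟨
  (c + 1ℚ) * toℚ Dₛ                      ∎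
  where
  open ≤-Reasoning
  instance
    c-nonNeg : NonNegative c
    c-nonNeg = nonNegative 0≤c
  Dₛ = degMax allA s
  A₁ : VSet m
  A₁ a = E₁ a (s a)
  optimal₁ = optimal-exists A₁ E₁ {s} (λ _ A₁a → A₁a)
  t₁ = proj₁ optimal₁
  t₁-optimal = proj₂ optimal₁
  t₁≤s : degMax A₁ t₁ ℕ.≤ Dₛ
  t₁≤s = ℕₚ.≤-trans (noDegMinPath⇒degMax-minimal A₁ E₁ t₁ (proj₂ t₁-optimal) (λ _ A₁a → A₁a))
                    (degMax-mono (λ _ _ → refl) s)
  chosen = hyp A₁ (λ a A₁a → s a , A₁a)
  t′ = proj₁ chosen
  t′-sm = proj₁ (proj₁ (proj₂ chosen))
  t′-bound = proj₂ (proj₂ chosen) t₁ t₁-optimal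
  w-sm : IsSemiMatching allA (E₁' ∪ₑ E₂) (patch A₁ t′ s)
  w-sm = patch-isSemiMatching {F = E₁' ∪ₑ E₂}
    (isSemiMatching-mono (⊆ₑ-∪ₑˡ E₁' E₂) t′-sm)
    (isSemiMatching-mono (⊆ₑ-∪ₑʳ E₁' E₂) (outside-E₁-isSemiMatching partition s-sm))
  t≤w : degMax allA t ℕ.≤ degMax allA (patch A₁ t′ s)
  t≤w = noDegMinPath⇒degMax-minimal allA (E₁' ∪ₑ E₂) t t-optimal w-sm
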